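{- Let $\pi$ be a permutation of $[n]$, $m\ge1$ and $T\ge0$. Then $\pi$ can be sorted by $m$ queues in $T$ rounds (i.e. there exist $\rho_t:[n]\to\{0,\dots,m-1\}$, $t\in[T]$, such that the $T$-round queue shuffle of $\pi$ with $(\rho_1,\dots,\rho_T)$ is the identity) if and only if $\mathrm{ascrun}(\pi)\le m^T$.
   Context: A deck of cards labelled by $[n]$ is represented by a permutation $\pi$ of $[n]$ with $\pi(s)$ the position (from the top) of label $s$. A single-round queue shuffle with pile assignments $\rho$ maps $\pi$ to the unique permutation $\sigma$ of $[n]$ with $\sigma(s)<\sigma(t)$ iff $(\rho(s),\pi(s))<(\rho(t),\pi(t))$ lexicographically. A $T$-round queue shuffle with $(\rho_1,\dots,\rho_T)$ maps $\pi$ to $\pi_T$, where $\pi_0=\pi$ and $\pi_t$ is the single-round queue shuffle of $\pi_{t-1}$ with $\rho_t$ (for $T=0$ the result is $\pi$ itself). $\mathrm{ascrun}(\pi)$ is the number of ascending runs (maximal contiguous increasing segments) of $(\pi(1),\dots,\pi(n))$. -}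

module Defs where

open import Data.Nat using (ℕ; zero; suc; _<ᵇ_; _≡ᵇ_; _+_)
open import Data.Bool using (Bool; true; false; _∨_; _∧_; if_then_else_)
open import Data.Fin using (Fin; toℕ)
open import Data.List using (List; []; _∷_; length; filterᵇ; allFin; map)
open import Data.Vec using (Vec; []; _∷_)

-- A deck configuration: label s ↦ position of s (positions 0-indexed, as naturals).
-- Only the relative order of positions matters for a queue shuffle.
Config : ℕ → Set
Config n = Fin n → ℕ

lexLt : ℕ → ℕ → ℕ → ℕ → Bool
lexLt a b c d = (a <ᵇ c) ∨ ((a ≡ᵇ c) ∧ (b <ᵇ d))

-- Single-round queue shuffle with pile assignment ρ : σ(s) is the number of
-- labels t with (ρ t , π t) < (ρ s , π s) lexicographically; when π is
-- injective this is the unique permutation σ with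
-- σ s < σ t  iff  (ρ s , π s) < (ρ t , π t).
queueShuffle : ∀ {n m} → (Fin n → Fin m) → Config n → Config n
queueShuffle {n} ρ π s =
  length (filterᵇ (λ t → lexLt (toℕ (ρ t)) (π t) (toℕ (ρ s)) (π s)) (allFin n))

queueShuffleT : ∀ {n m T} → Vec (Fin n → Fin m) T → Config n → Config n
queueShuffleT []       π = π
queueShuffleT (ρ ∷ ρs) π = queueShuffleT ρs (queueShuffle ρ π)

runsList : List ℕ → ℕ
runsList []           = 0
runsList (x ∷ [])     = 1
runsList (x ∷ y ∷ xs) = if x <ᵇ y then runsList (y ∷ xs) else suc (runsList (y ∷ xs))

ascrun : ∀ {n} → Config n → ℕ
ascrun {n} π = runsList (map π (allFin n))

module Submission where

-- Each round is a stable sort by pile, so after rounds ρ₁ … ρ_T label s comes before label t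
-- iff (ρ_T s, …, ρ₁ s, π s) is lexicographically smaller, i.e. iff d s · n + π s is smaller,
-- where d s < m^T is the number with base-m digits ρ₁ s, …, ρ_T s (least significant first).
-- The deck is therefore sorted iff s ↦ (d s, π s) increases lexicographically along consecutive
-- labels: d is weakly increasing and grows at every descent of π, so it takes at least
-- ascrun π values. Conversely d s = number of descents of π before s works, and every
-- d < m^T arises from some choice of piles.

open import Defs
open import Data.Nat using (ℕ; _≤_; _^_)
open import Data.Fin using (Fin; toℕ)
open import Data.Fin.Permutation using (Permutation′; _⟨$⟩ʳ_)
open import Data.Vec using (Vec)
open import Data.Product using (Σ)
open import Function.Bundles using (_⇔_)
open import Relation.Binary.PropositionalEquality using (_≡_)

open import Data.Bool using (Bool; true; false; T; T?; if_then_else_)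
open import Data.Bool.Properties using (T-∨; T-∧)
open import Data.Empty using (⊥-elim)
open import Data.Fin using (zero; suc; inject₁; fromℕ<)
open import Data.Fin.Properties using (toℕ<n; toℕ-fromℕ<; toℕ-inject₁)
open import Data.List using ([]; _∷_; length; filterᵇ; allFin; tabulate)
open import Data.List.Membership.Propositional using (_∈_)
open import Data.List.Membership.Propositional.Properties using (∈-allFin)
open import Data.List.Properties using (map-tabulate; length-tabulate; filter-≐; filter-notAll)
open import Data.List.Relation.Unary.Any as Any using (here; there)
open import Data.Nat
  using (zero; suc; _+_; _*_; _<_; _<ᵇ_; _<?_; _/_; _%_; z≤n; s≤s; s≤s⁻¹; z<s; s<s; NonZero; >-nonZero)
open import Data.Nat.DivMod using (m≡m%n+[m/n]*n; m%n<n; m<n*o⇒m/o<n)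
open import Data.Nat.Properties
open import Data.Nat.Solver using (module +-*-Solver)
open import Data.Product as Product using (_,_; _×_)
open import Data.Product.Relation.Binary.Lex.Strict using (×-Lex)
open import Data.Sum as Sum using (inj₁; inj₂)
open import Data.Vec using ([]; _∷_; replicate)
open import Function using (_∘_; id)
open import Function.Bundles using (mk⇔; module Equivalence)
open import Function.Construct.Composition using (_⇔-∘_)
import Function.Properties.Equivalence as ⇔
open import Relation.Binary.Core using (Rel)
open import Relation.Binary.Definitions using (tri<; tri≈; tri>)
open import Relation.Binary.PropositionalEquality
  using (refl; sym; trans; cong; cong₂; subst; subst₂; _≗_; module ≡-Reasoning)
open import Relation.Nullary using (¬_; contradiction; yes; no)

open Equivalence using (to; from)

<⇔T<ᵇ : ∀ {a b} → a < b ⇔ T (a <ᵇ b)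
<⇔T<ᵇ = mk⇔ <⇒<ᵇ (<ᵇ⇒< _ _)

_<lex_ : Rel (ℕ × ℕ) _
_<lex_ = ×-Lex _≡_ _<_ _<_

T-lexLt : ∀ a b c e → T (lexLt a b c e) ⇔ (a , b) <lex (c , e)
T-lexLt a b c e = mk⇔ ⇒lex lex⇒
  where
  ⇒lex : T (lexLt a b c e) → (a , b) <lex (c , e)
  ⇒lex h with to T-∨ h
  ... | inj₁ a<c = inj₁ (<ᵇ⇒< a c a<c)
  ... | inj₂ h′ with to T-∧ h′
  ...   | a≡c , b<e = inj₂ (≡ᵇ⇒≡ a c a≡c , <ᵇ⇒< b e b<e)
  lex⇒ : (a , b) <lex (c , e) → T (lexLt a b c e)
  lex⇒ (inj₁ a<c) = from T-∨ (inj₁ (<⇒<ᵇ a<c))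
  lex⇒ (inj₂ (refl , b<e)) = from T-∨ (inj₂ (from T-∧ (≡⇒≡ᵇ a a refl , <⇒<ᵇ b<e)))

<lex-cong₂ : ∀ {a b c e b′ e′} → (b < e ⇔ b′ < e′) →
             (a , b) <lex (c , e) ⇔ (a , b′) <lex (c , e′)
<lex-cong₂ b<e⇔b′<e′ = mk⇔ (Sum.map₂ (Product.map₂ (to b<e⇔b′<e′)))
                           (Sum.map₂ (Product.map₂ (from b<e⇔b′<e′)))

<lex-irrefl : ∀ {x} → ¬ x <lex x
<lex-irrefl (inj₁ a<a) = <-irrefl refl a<a
<lex-irrefl (inj₂ (_ , b<b)) = <-irrefl refl b<b

<lex-+ˡ : ∀ k {a b c e} → (a , b) <lex (c , e) → (k + a , b) <lex (k + c , e)
<lex-+ˡ k (inj₁ a<c)        = inj₁ (+-monoʳ-< k a<c)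
<lex-+ˡ k (inj₂ (refl , b<e)) = inj₂ (refl , b<e)

*+<* : ∀ {a b c B} → a < c → b < B → a * B + b < c * B
*+<* {a} {b} {c} {B} a<c b<B = begin-strict
  a * B + b  <⟨ +-monoʳ-< (a * B) b<B ⟩
  a * B + B  ≡⟨ +-comm (a * B) B ⟩
  suc a * B  ≤⟨ *-monoˡ-≤ B a<c ⟩
  c * B      ∎
  where open ≤-Reasoning

<lex⇔*+< : ∀ {a b c e B} → b < B → e < B → (a , b) <lex (c , e) ⇔ a * B + b < c * B + e
<lex⇔*+< {a} {b} {c} {e} {B} b<B e<B = mk⇔ (lex⇒ b<B) *+<⇒
  where
  lex⇒ : ∀ {a b c e} → b < B → (a , b) <lex (c , e) → a * B + b < c * B + e
  lex⇒ {c = c} {e} b<B (inj₁ a<c) = <-≤-trans (*+<* a<c b<B) (m≤m+n (c * B) e)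
  lex⇒ {a} _ (inj₂ (refl , b<e)) = +-monoʳ-< (a * B) b<e
  *+<⇒ : a * B + b < c * B + e → (a , b) <lex (c , e)
  *+<⇒ lt with <-cmp a c
  ... | tri< a<c _ _ = inj₁ a<c
  ... | tri≈ _ refl _ = inj₂ (refl , +-cancelˡ-< (a * B) b e lt)
  ... | tri> _ _ c<a = contradiction lt (<⇒≯ (lex⇒ e<B (inj₁ c<a)))

SameOrder : ∀ {n} → (Fin n → ℕ) → (Fin n → ℕ) → Set
SameOrder G K = ∀ s t → G s < G t ⇔ K s < K t

≗⇒sameOrder : ∀ {n} {G K : Fin n → ℕ} → G ≗ K → SameOrder G K
≗⇒sameOrder G≗K s t rewrite G≗K s | G≗K t = ⇔.refl

sameOrder-trans : ∀ {n} {G H K : Fin n → ℕ} → SameOrder G H → SameOrder H K → SameOrder G K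
sameOrder-trans G~H H~K s t = H~K s t ⇔-∘ G~H s t

module _ {A : Set} (p q : A → Bool) (p⇒q : ∀ x → T (p x) → T (q x)) where

  length-filterᵇ-mono : ∀ xs → length (filterᵇ p xs) ≤ length (filterᵇ q xs)
  length-filterᵇ-mono []       = z≤n
  length-filterᵇ-mono (x ∷ xs) with p x | q x | p⇒q x
  ... | true  | true  | _     = s≤s (length-filterᵇ-mono xs)
  ... | true  | false | px⇒qx = ⊥-elim (px⇒qx _)
  ... | false | true  | _     = m≤n⇒m≤1+n (length-filterᵇ-mono xs)
  ... | false | false | _     = length-filterᵇ-mono xs

  length-filterᵇ-strict : ∀ {y} xs → y ∈ xs → ¬ T (p y) → T (q y) →
                          length (filterᵇ p xs) < length (filterᵇ q xs)
  length-filterᵇ-strict (x ∷ xs) (here refl) ¬py qy with p x | q x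
  ... | true  | _     = contradiction _ ¬py
  ... | false | false = contradiction qy λ ()
  ... | false | true  = s≤s (length-filterᵇ-mono xs)
  length-filterᵇ-strict (x ∷ xs) (there y∈xs) ¬py qy with p x | q x | p⇒q x
  ... | true  | true  | _     = s<s (length-filterᵇ-strict xs y∈xs ¬py qy)
  ... | true  | false | px⇒qx = ⊥-elim (px⇒qx _)
  ... | false | true  | _     = m<n⇒m<1+n (length-filterᵇ-strict xs y∈xs ¬py qy)
  ... | false | false | _     = length-filterᵇ-strict xs y∈xs ¬py qy

rank : ∀ {n} → (Fin n → ℕ) → Fin n → ℕ
rank {n} K s = length (filterᵇ (λ t → K t <ᵇ K s) (allFin n))

rank-mono-≤ : ∀ {n} (K : Fin n → ℕ) {s t} → K s ≤ K t → rank K s ≤ rank K t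
rank-mono-≤ {n} K Ks≤Kt =
  length-filterᵇ-mono _ _ (λ u Ku<Ks → <⇒<ᵇ (<-≤-trans (<ᵇ⇒< _ _ Ku<Ks) Ks≤Kt)) (allFin n)

rank-mono-< : ∀ {n} (K : Fin n → ℕ) {s t} → K s < K t → rank K s < rank K t
rank-mono-< {n} K {s} Ks<Kt =
  length-filterᵇ-strict _ _ (λ u Ku<Ks → <⇒<ᵇ (<-trans (<ᵇ⇒< _ _ Ku<Ks) Ks<Kt))
    (allFin n) (∈-allFin s) (<-irrefl refl ∘ <ᵇ⇒< (K s) (K s)) (<⇒<ᵇ Ks<Kt)

rank-sameOrder : ∀ {n} (K : Fin n → ℕ) → SameOrder (rank K) K
rank-sameOrder K s t = mk⇔ rank<⇒ (rank-mono-< K)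
  where
  rank<⇒ : rank K s < rank K t → K s < K t
  rank<⇒ r< with K s <? K t
  ... | yes Ks<Kt = Ks<Kt
  ... | no  Ks≮Kt = contradiction (rank-mono-≤ K (≮⇒≥ Ks≮Kt)) (<⇒≱ r<)

queueShuffle<n : ∀ {n m} (ρ : Fin n → Fin m) (π : Fin n → ℕ) s → queueShuffle ρ π s < n
queueShuffle<n {n} ρ π s = subst (queueShuffle ρ π s <_) (length-tabulate id)
  (filter-notAll (T? ∘ below) (allFin n) (Any.map (λ { refl → ¬below-self }) (∈-allFin s)))
  where
  below : Fin n → Bool
  below t = lexLt (toℕ (ρ t)) (π t) (toℕ (ρ s)) (π s)
  ¬below-self : ¬ T (below s)
  ¬below-self = <lex-irrefl ∘ to (T-lexLt (toℕ (ρ s)) (π s) (toℕ (ρ s)) (π s))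

queueShuffle≗rank : ∀ {n m} (ρ : Fin n → Fin m) {π K : Fin n → ℕ} {B} →
                    SameOrder π K → (∀ s → K s < B) →
                    queueShuffle ρ π ≗ rank (λ s → toℕ (ρ s) * B + K s)
queueShuffle≗rank {n} ρ {π} {K} {B} π~K K<B s =
  cong length (filter-≐ (T? ∘ below) (T? ∘ keyBelow) (to (below⇔ _) , from (below⇔ _)) (allFin n))
  where
  key : Fin n → ℕ
  key t = toℕ (ρ t) * B + K t
  below keyBelow : Fin n → Bool
  below t = lexLt (toℕ (ρ t)) (π t) (toℕ (ρ s)) (π s)
  keyBelow t = key t <ᵇ key s
  below⇔ : ∀ t → T (below t) ⇔ T (keyBelow t)
  below⇔ t = <⇔T<ᵇ ⇔-∘ (<lex⇔*+< (K<B t) (K<B s) ⇔-∘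
               (<lex-cong₂ (π~K t s) ⇔-∘ T-lexLt (toℕ (ρ t)) (π t) (toℕ (ρ s)) (π s)))

pileCode : ∀ {n m T} → Vec (Fin n → Fin m) T → Fin n → ℕ
pileCode []               s = 0
pileCode {m = m} (ρ ∷ ρs) s = toℕ (ρ s) + m * pileCode ρs s

pileCode<m^T : ∀ {n m T} (ρs : Vec (Fin n → Fin m) T) s → pileCode ρs s < m ^ T
pileCode<m^T [] s = z<s
pileCode<m^T {m = m} {suc T} (ρ ∷ ρs) s = begin-strict
  toℕ (ρ s) + m * pileCode ρs s  <⟨ +-monoˡ-< (m * pileCode ρs s) (toℕ<n (ρ s)) ⟩
  m + m * pileCode ρs s          ≡⟨ *-suc m (pileCode ρs s) ⟨
  m * suc (pileCode ρs s)        ≤⟨ *-monoʳ-≤ m (pileCode<m^T ρs s) ⟩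
  m * m ^ T                      ∎
  where open ≤-Reasoning

queueShuffleT-sameOrder : ∀ {n m T} (ρs : Vec (Fin n → Fin m) T) {π K : Fin n → ℕ} {B} →
                          SameOrder π K → (∀ s → K s < B) →
                          SameOrder (queueShuffleT ρs π) (λ s → pileCode ρs s * B + K s)
queueShuffleT-sameOrder [] π~K _ = π~K
queueShuffleT-sameOrder {n} {m} (ρ ∷ ρs) {π} {K} {B} π~K K<B =
  sameOrder-trans (queueShuffleT-sameOrder ρs π′~K′ K′<mB) (≗⇒sameOrder regroup)
  where
  open +-*-Solver
  K′ : Fin n → ℕ
  K′ s = toℕ (ρ s) * B + K s
  π′~K′ : SameOrder (queueShuffle ρ π) K′
  π′~K′ = sameOrder-trans (≗⇒sameOrder (queueShuffle≗rank ρ π~K K<B)) (rank-sameOrder K′)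
  K′<mB : ∀ s → K′ s < m * B
  K′<mB s = *+<* (toℕ<n (ρ s)) (K<B s)
  regroup : ∀ s → pileCode ρs s * (m * B) + K′ s ≡ pileCode (ρ ∷ ρs) s * B + K s
  regroup s = solve 5 (λ d m b r k → d :* (m :* b) :+ (r :* b :+ k) := (r :+ m :* d) :* b :+ k) refl
                (pileCode ρs s) m B (toℕ (ρ s)) (K s)

queueShuffleT<n : ∀ {n m T} (ρs : Vec (Fin n → Fin m) T) {π : Fin n → ℕ} →
                  (∀ s → π s < n) → ∀ s → queueShuffleT ρs π s < n
queueShuffleT<n []       π<n = π<n
queueShuffleT<n (ρ ∷ ρs) {π} _ = queueShuffleT<n ρs (queueShuffle<n ρ π)

pilesOf : ∀ {n} m .{{_ : NonZero m}} T → (Fin n → ℕ) → Vec (Fin n → Fin m) T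
pilesOf m zero    d = []
pilesOf m (suc T) d = (λ s → fromℕ< (m%n<n (d s) m)) ∷ pilesOf m T (λ s → d s / m)

pileCode-pilesOf : ∀ {n} m .{{_ : NonZero m}} T (d : Fin n → ℕ) s →
                   d s < m ^ T → pileCode (pilesOf m T d) s ≡ d s
pileCode-pilesOf m zero    d s d<1 = sym (n<1⇒n≡0 d<1)
pileCode-pilesOf m (suc T) d s d<m^1+T = begin
  toℕ (fromℕ< (m%n<n (d s) m)) + m * pileCode (pilesOf m T (λ s → d s / m)) s
    ≡⟨ cong₂ _+_ (toℕ-fromℕ< _) (cong (m *_) (pileCode-pilesOf m T _ s (m<n*o⇒m/o<n d<m^T*m))) ⟩
  d s % m + m * (d s / m)  ≡⟨ cong (d s % m +_) (*-comm m (d s / m)) ⟩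
  d s % m + d s / m * m    ≡⟨ m≡m%n+[m/n]*n (d s) m ⟨
  d s                      ∎
  where
  open ≡-Reasoning
  d<m^T*m : d s < m ^ T * m
  d<m^T*m = subst (d s <_) (*-comm m (m ^ T)) d<m^1+T

Ascending : {A : Set} → (A → A → Set) → ∀ {n} → (Fin (suc n) → A) → Set
Ascending _≺_ F = ∀ i → F (inject₁ i) ≺ F (suc i)

ascending-squeeze : ∀ {n} c (F : Fin (suc n) → ℕ) → Ascending _<_ F →
                    c ≤ F zero → (∀ s → F s < suc n + c) → ∀ s → F s ≡ toℕ s + c
ascending-squeeze {zero}  c F _   c≤F₀ F< zero = ≤-antisym (s≤s⁻¹ (F< zero)) c≤F₀
ascending-squeeze {suc n} c F asc c≤F₀ F< = λ
  { zero    → ≤-antisym (s≤s⁻¹ (subst (F zero <_) (F∘suc≡ zero) (asc zero))) c≤F₀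
  ; (suc s) → trans (F∘suc≡ s) (+-suc (toℕ s) c)
  }
  where
  F∘suc≡ : ∀ s → F (suc s) ≡ toℕ s + suc c
  F∘suc≡ = ascending-squeeze (suc c) (F ∘ suc) (asc ∘ suc) (≤-<-trans c≤F₀ (asc zero))
             (λ s → subst (F (suc s) <_) (sym (cong suc (+-suc n c))) (F< (suc s)))

ascending<n⇒≗toℕ : ∀ {n} (F : Fin (suc n) → ℕ) → Ascending _<_ F →
                   (∀ s → F s < suc n) → F ≗ toℕ
ascending<n⇒≗toℕ {n} F asc F<n s =
  trans (ascending-squeeze 0 F asc z≤n (λ t → subst (F t <_) (sym (+-identityʳ (suc n))) (F<n t)) s)
        (+-identityʳ (toℕ s))

sorts⇔ascending : ∀ {n m T} (ρs : Vec (Fin (suc n) → Fin m) T) (π : Fin (suc n) → ℕ) →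
                  (∀ s → π s < suc n) →
                  queueShuffleT ρs π ≗ toℕ ⇔ Ascending _<lex_ (λ s → pileCode ρs s , π s)
sorts⇔ascending {n} ρs π π<n = mk⇔ sorted⇒ ⇒sorted
  where
  F : Fin (suc n) → ℕ
  F = queueShuffleT ρs π
  F<⇔<lex : ∀ s t → F s < F t ⇔ (pileCode ρs s , π s) <lex (pileCode ρs t , π t)
  F<⇔<lex s t =
    ⇔.sym (<lex⇔*+< (π<n s) (π<n t)) ⇔-∘ queueShuffleT-sameOrder ρs (λ _ _ → ⇔.refl) π<n s t
  sorted⇒ : F ≗ toℕ → Ascending _<lex_ (λ s → pileCode ρs s , π s)
  sorted⇒ F≗toℕ i = to (F<⇔<lex (inject₁ i) (suc i))
    (subst₂ _<_ (sym (F≗toℕ (inject₁ i))) (sym (F≗toℕ (suc i)))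
      (s≤s (≤-reflexive (toℕ-inject₁ i))))
  ⇒sorted : Ascending _<lex_ (λ s → pileCode ρs s , π s) → F ≗ toℕ
  ⇒sorted asc =
    ascending<n⇒≗toℕ F (λ i → from (F<⇔<lex (inject₁ i) (suc i)) (asc i)) (queueShuffleT<n ρs π<n)

-- Built with tabulate rather than map over allFin, so that it unfolds along Fin.suc.
runs : ∀ {n} → (Fin n → ℕ) → ℕ
runs f = runsList (tabulate f)

ascrun≡runs : ∀ {n} (f : Fin n → ℕ) → ascrun f ≡ runs f
ascrun≡runs f = cong runsList (map-tabulate id f)

descentsBefore : ∀ {n} → (Fin (suc n) → ℕ) → Fin (suc n) → ℕ
descentsBefore f zero = 0
descentsBefore {suc n} f (suc i) = (if f zero <ᵇ f (suc zero) then 0 else 1) + descentsBefore (f ∘ suc) i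

descentsBefore<runs : ∀ {n} (f : Fin (suc n) → ℕ) s → descentsBefore f s < runs f
descentsBefore<runs {zero} f zero = z<s
descentsBefore<runs {suc n} f zero with f zero <ᵇ f (suc zero)
... | true  = descentsBefore<runs (f ∘ suc) zero
... | false = z<s
descentsBefore<runs {suc n} f (suc i) with f zero <ᵇ f (suc zero)
... | true  = descentsBefore<runs (f ∘ suc) i
... | false = s<s (descentsBefore<runs (f ∘ suc) i)

descentsBefore-ascending : ∀ {n} (f : Fin (suc n) → ℕ) →
                           Ascending _<lex_ (λ s → descentsBefore f s , f s)
descentsBefore-ascending {suc n} f zero with f zero <ᵇ f (suc zero) in f₀<ᵇf₁
... | true  = inj₂ (refl , <ᵇ⇒< _ _ (subst T (sym f₀<ᵇf₁) _))
... | false = inj₁ z<s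
descentsBefore-ascending {suc n} f (suc i) =
  <lex-+ˡ (if f zero <ᵇ f (suc zero) then 0 else 1) (descentsBefore-ascending (f ∘ suc) i)

-- A new run starts exactly where f descends, and there the lexicographic order forces d to grow.
runs+d₀≤runs+d₁ : ∀ {n} (d f : Fin (suc (suc n)) → ℕ) →
                  (d zero , f zero) <lex (d (suc zero) , f (suc zero)) →
                  runs f + d zero ≤ runs (f ∘ suc) + d (suc zero)
runs+d₀≤runs+d₁ d f lex with f zero <ᵇ f (suc zero) in f₀<ᵇf₁ | lex
... | true  | inj₁ d₀<d₁ = +-monoʳ-≤ (runs (f ∘ suc)) (<⇒≤ d₀<d₁)
... | true  | inj₂ (d₀≡d₁ , _) = +-monoʳ-≤ (runs (f ∘ suc)) (≤-reflexive d₀≡d₁)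
... | false | inj₁ d₀<d₁ = +-monoʳ-< (runs (f ∘ suc)) d₀<d₁
... | false | inj₂ (_ , f₀<f₁) = contradiction (subst T f₀<ᵇf₁ (<⇒<ᵇ f₀<f₁)) λ ()

runs+d₀≤ : ∀ {n} (d f : Fin (suc n) → ℕ) {M} →
           Ascending _<lex_ (λ s → d s , f s) → (∀ s → d s < M) →
           runs f + d zero ≤ M
runs+d₀≤ {zero}  d f asc d<M = d<M zero
runs+d₀≤ {suc n} d f asc d<M =
  ≤-trans (runs+d₀≤runs+d₁ d f (asc zero))
          (runs+d₀≤ (d ∘ suc) (f ∘ suc) (asc ∘ suc) (d<M ∘ suc))

sortable⇒runs≤ : ∀ {n m T} (π : Fin (suc n) → ℕ) → (∀ s → π s < suc n) →
                 (ρs : Vec (Fin (suc n) → Fin m) T) → queueShuffleT ρs π ≗ toℕ → runs π ≤ m ^ T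
sortable⇒runs≤ π π<n ρs sorted =
  ≤-trans (m≤m+n (runs π) _)
          (runs+d₀≤ (pileCode ρs) π (to (sorts⇔ascending ρs π π<n) sorted) (pileCode<m^T ρs))

runs≤⇒sortable : ∀ {n} m .{{_ : NonZero m}} T (π : Fin (suc n) → ℕ) →
                 (∀ s → π s < suc n) →
                 runs π ≤ m ^ T → Σ (Vec (Fin (suc n) → Fin m) T) (λ ρs → queueShuffleT ρs π ≗ toℕ)
runs≤⇒sortable m T π π<n runs≤ = ρs , from (sorts⇔ascending ρs π π<n) ascending
  where
  d : Fin _ → ℕ
  d = descentsBefore π
  ρs : Vec (Fin _ → Fin m) T
  ρs = pilesOf m T d
  code≡d : ∀ s → pileCode ρs s ≡ d s
  code≡d s = pileCode-pilesOf m T d s (<-≤-trans (descentsBefore<runs π s) runs≤)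
  ascending : Ascending _<lex_ (λ s → pileCode ρs s , π s)
  ascending i rewrite code≡d (inject₁ i) | code≡d (suc i) = descentsBefore-ascending π i

corollary5 : (n m T : ℕ) → (π : Permutation′ n) → 1 ≤ m →
    (Σ (Vec (Fin n → Fin m) T) (λ ρs → (s : Fin n) → queueShuffleT ρs (λ x → toℕ (π ⟨$⟩ʳ x)) s ≡ toℕ s))
    ⇔ (ascrun (λ x → toℕ (π ⟨$⟩ʳ x)) ≤ m ^ T)
corollary5 zero    m T π _   = mk⇔ (λ _ → z≤n) (λ _ → replicate T (λ ()) , λ ())
corollary5 (suc n) m T π 1≤m = mk⇔
  (λ (ρs , sorted) → subst (_≤ m ^ T) (sym (ascrun≡runs f)) (sortable⇒runs≤ f f<n ρs sorted))
  (runs≤⇒sortable m T f f<n ∘ subst (_≤ m ^ T) (ascrun≡runs f))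
  where
  instance
    m≢0 : NonZero m
    m≢0 = >-nonZero 1≤m
  f : Fin (suc n) → ℕ
  f s = toℕ (π ⟨$⟩ʳ s)
  f<n : ∀ s → f s < suc n
  f<n s = toℕ<n (π ⟨$⟩ʳ s)
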